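{- Let $p:\mathcal E\to\mathcal I$ be a monoidal closed bifibration, and let $H$ be an object of $\mathcal I$ with a monoid structure $\circledast:H\otimes H\to H$, $\mathrm{emp}:\mathbf 1\to H$. For e-types $S,T\sqsubset H$ define $S*T:=\circledast_{!}(S\otimes T)\sqsubset H$ and $S\mathbin{ -\!*}T:=\rho(\circledast)^{*}(T/S)\sqsubset H$, where $\rho(\circledast):H\to H/H$. Then, for all e-types refining $H$, there are: an operation $M_*$ sending derivations $\alpha_1$ of $S_1\le T_1$ and $\alpha_2$ of $S_2\le T_2$ to a derivation $M_*(\alpha_1,\alpha_2)$ of $S_1*S_2\le T_1*T_2$; an operation $\Phi$ sending derivations $\beta$ of $S*T\le U$ to derivations $\Phi(\beta)$ of $S\le T\mathbin{ -\!*}U$; and a derivation $\varepsilon_{T,U}$ of $(T\mathbin{ -\!*}U)*T\le U$; such that for all derivations $\beta$ of $S*T\le U$ and $\eta$ of $S\le T\mathbin{ -\!*}U$, $$M_*(\Phi(\beta),\mathrm{id}_T);\varepsilon_{T,U}=\beta\qquad\text{and}\qquad \Phi\big(M_*(\eta,\mathrm{id}_T);\varepsilon_{T,U}\big)=\eta.$$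
   Context: A type refinement system is a functor $p:\mathcal E\to\mathcal I$; objects/morphisms of $\mathcal I$ are i-types/expressions, of $\mathcal E$ are e-types/derivations; composition is diagrammatic ($f;g$ = $f$ then $g$). $S\sqsubset A$ means $p(S)=A$. A derivation of $S\Rightarrow_f T$ is a morphism $\alpha:S\to T$ in $\mathcal E$ with $p(\alpha)=f$; $S\le T$ denotes $S\Rightarrow_{\mathrm{id}}T$. For $f:A\to B$, $T\sqsubset B$: a pullback $f^*T\sqsubset A$ comes with a cartesian derivation of $f^*T\Rightarrow_f T$ (every derivation of $S\Rightarrow_{g;f}T$ factors uniquely as a derivation of $S\Rightarrow_g f^*T$ followed by it). For $S\sqsubset A$: a pushforward $f_!S\sqsubset B$ comes with an opcartesian derivation of $S\Rightarrow_f f_!S$ (every derivation of $S\Rightarrow_{f;g}T$ factors uniquely as it followed by a derivation of $f_!S\Rightarrow_g T$). $\mathcal I$ is monoidal closed with product $\otimes$, unit $\mathbf 1$, left residuals $A\backslash C$ (evaluation $\mathrm{ev}^l:A\otimes(A\backslash C)\to C$, currying bijection $\lambda:\mathrm{Hom}(A\otimes X,C)\cong\mathrm{Hom}(X,A\backslash C)$) and right residuals $C/B$ (evaluation $\mathrm{ev}^r:(C/B)\otimes B\to C$, currying bijection $\rho:\mathrm{Hom}(X\otimes B,C)\cong\mathrm{Hom}(X,C/B)$) with the usual $\beta\eta$ equations. A monoidal closed bifibration is a strong monoidal functor $p$ (with $S\otimes T\sqsubset A\otimes B$ when $S\sqsubset A,T\sqsubset B$; tensor of derivations lies over tensor of expressions)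 having all pullbacks and pushforwards, both preserved by $\otimes$ up to vertical isomorphism, and having for all $S\sqsubset A$, $T\sqsubset B$, $U\sqsubset C$ e-types $S\backslash U\sqsubset A\backslash C$, $U/T\sqsubset C/B$ with evaluation derivations over $\mathrm{ev}^l$, $\mathrm{ev}^r$ and currying operations on derivations over $\lambda$, $\rho$ satisfying the $\beta\eta$ equations (i.e. they are residuals lying over the residuals of $\mathcal I$). $\mathrm{id}_T$ denotes the identity derivation of $T\le T$. -}

module Defs where

-- Conventions:
--  * categories have hom-TYPES with propositional equality of morphisms;
--  * composition is diagrammatic:  f ⨾ g  = f then g;
--  * a type refinement system p : E → I is presented as a category E whose
--    objects are pairs (A , S) with S : Ref A  (so p on objects is the first
--    projection, and  S ⊏ A  means  S : Ref A), together with the action of p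
--    on morphisms and the functor laws.

open import Level using (Level; _⊔_) renaming (suc to lsuc)
open import Data.Product using (Σ; _,_; proj₁; proj₂; _×_)
open import Relation.Binary.PropositionalEquality using (_≡_; refl; sym; trans; cong)

record Category (o h : Level) : Set (lsuc (o ⊔ h)) where
  infixr 9 _⨾_
  field
    Obj  : Set o
    Hom  : Obj → Obj → Set h
    id   : ∀ {A} → Hom A A
    _⨾_  : ∀ {A B C} → Hom A B → Hom B C → Hom A C
    idˡ  : ∀ {A B} (f : Hom A B) → id ⨾ f ≡ f
    idʳ  : ∀ {A B} (f : Hom A B) → f ⨾ id ≡ f
    assoc : ∀ {A B C D} (f : Hom A B) (g : Hom B C) (k : Hom C D) →
            (f ⨾ g) ⨾ k ≡ f ⨾ (g ⨾ k)

record IsMonoidal {o h : Level} (C : Category o h)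
                  (_⊗₀_ : Category.Obj C → Category.Obj C → Category.Obj C)
                  (𝟏 : Category.Obj C) : Set (o ⊔ h) where
  open Category C
  infixr 10 _⊗₁_
  field
    _⊗₁_   : ∀ {A B A' B'} → Hom A B → Hom A' B' → Hom (A ⊗₀ A') (B ⊗₀ B')
    ⊗-id   : ∀ {A B} → id {A} ⊗₁ id {B} ≡ id
    ⊗-comp : ∀ {A B C' A' B' C''} (f : Hom A B) (g : Hom B C') (f' : Hom A' B') (g' : Hom B' C'') →
             (f ⨾ g) ⊗₁ (f' ⨾ g') ≡ (f ⊗₁ f') ⨾ (g ⊗₁ g')
    assocʳ : ∀ {A B D} → Hom ((A ⊗₀ B) ⊗₀ D) (A ⊗₀ (B ⊗₀ D))
    assocˡ : ∀ {A B D} → Hom (A ⊗₀ (B ⊗₀ D)) ((A ⊗₀ B) ⊗₀ D)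
    assoc-iso₁ : ∀ {A B D} → assocʳ {A} {B} {D} ⨾ assocˡ ≡ id
    assoc-iso₂ : ∀ {A B D} → assocˡ {A} {B} {D} ⨾ assocʳ ≡ id
    assoc-nat  : ∀ {A B D A' B' D'} (f : Hom A A') (g : Hom B B') (k : Hom D D') →
                 ((f ⊗₁ g) ⊗₁ k) ⨾ assocʳ ≡ assocʳ ⨾ (f ⊗₁ (g ⊗₁ k))
    unitˡ  : ∀ {A} → Hom (𝟏 ⊗₀ A) A
    unitˡ⁻ : ∀ {A} → Hom A (𝟏 ⊗₀ A)
    unitˡ-iso₁ : ∀ {A} → unitˡ {A} ⨾ unitˡ⁻ ≡ id
    unitˡ-iso₂ : ∀ {A} → unitˡ⁻ {A} ⨾ unitˡ ≡ id
    unitˡ-nat  : ∀ {A B} (f : Hom A B) → (id ⊗₁ f) ⨾ unitˡ ≡ unitˡ ⨾ f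
    unitʳ  : ∀ {A} → Hom (A ⊗₀ 𝟏) A
    unitʳ⁻ : ∀ {A} → Hom A (A ⊗₀ 𝟏)
    unitʳ-iso₁ : ∀ {A} → unitʳ {A} ⨾ unitʳ⁻ ≡ id
    unitʳ-iso₂ : ∀ {A} → unitʳ⁻ {A} ⨾ unitʳ ≡ id
    unitʳ-nat  : ∀ {A B} (f : Hom A B) → (f ⊗₁ id) ⨾ unitʳ ≡ unitʳ ⨾ f
    pentagon : ∀ {A B D F} →
               (assocʳ {A} {B} {D} ⊗₁ id {F}) ⨾ assocʳ ⨾ (id ⊗₁ assocʳ) ≡ assocʳ ⨾ assocʳ
    triangle : ∀ {A B} → assocʳ {A} {𝟏} {B} ⨾ (id ⊗₁ unitˡ) ≡ unitʳ ⊗₁ id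

record IsClosed {o h : Level} (C : Category o h)
                {_⊗₀_ : Category.Obj C → Category.Obj C → Category.Obj C}
                {𝟏 : Category.Obj C}
                (M : IsMonoidal C _⊗₀_ 𝟏)
                (_⧹_ : Category.Obj C → Category.Obj C → Category.Obj C)
                (_⧸_ : Category.Obj C → Category.Obj C → Category.Obj C)
                : Set (o ⊔ h) where
  open Category C
  open IsMonoidal M
  field
    evˡ    : ∀ {A D} → Hom (A ⊗₀ (A ⧹ D)) D
    curryˡ : ∀ {A X D} → Hom (A ⊗₀ X) D → Hom X (A ⧹ D)
    βˡ     : ∀ {A X D} (f : Hom (A ⊗₀ X) D) → (id ⊗₁ curryˡ f) ⨾ evˡ ≡ f
    ηˡ     : ∀ {A X D} (g : Hom X (A ⧹ D)) → curryˡ ((id ⊗₁ g) ⨾ evˡ) ≡ g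
    evʳ    : ∀ {B D} → Hom ((D ⧸ B) ⊗₀ B) D
    curryʳ : ∀ {B X D} → Hom (X ⊗₀ B) D → Hom X (D ⧸ B)
    βʳ     : ∀ {B X D} (f : Hom (X ⊗₀ B) D) → (curryʳ f ⊗₁ id) ⨾ evʳ ≡ f
    ηʳ     : ∀ {B X D} (g : Hom X (D ⧸ B)) → curryʳ ((g ⊗₁ id) ⨾ evʳ) ≡ g

-- Monoidal closed category (the category I of i-types / expressions)

record MonoidalClosedCategory (o h : Level) : Set (lsuc (o ⊔ h)) where
  field
    cat : Category o h
  open Category cat public
  infixr 10 _⊗_
  field
    _⊗_  : Obj → Obj → Obj
    𝟏    : Obj
    isMonoidal : IsMonoidal cat _⊗_ 𝟏
    _⧹_  : Obj → Obj → Obj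
    _⧸_  : Obj → Obj → Obj
    isClosed : IsClosed cat isMonoidal _⧹_ _⧸_
  open IsMonoidal isMonoidal public
  open IsClosed isClosed public

record RefinementSystem {o h : Level} (I : Category o h) (r e : Level)
       : Set (o ⊔ h ⊔ lsuc (r ⊔ e)) where
  open Category I
  infixr 9 _⨾ᴱ_
  field
    Ref   : Obj → Set r
    EHom  : ∀ {A B} → Ref A → Ref B → Set e
    p     : ∀ {A B} {S : Ref A} {T : Ref B} → EHom S T → Hom A B
    idᴱ   : ∀ {A} {S : Ref A} → EHom S S
    _⨾ᴱ_  : ∀ {A B C} {S : Ref A} {T : Ref B} {U : Ref C} → EHom S T → EHom T U → EHom S U
    idᴱˡ  : ∀ {A B} {S : Ref A} {T : Ref B} (α : EHom S T) → idᴱ ⨾ᴱ α ≡ α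
    idᴱʳ  : ∀ {A B} {S : Ref A} {T : Ref B} (α : EHom S T) → α ⨾ᴱ idᴱ ≡ α
    assocᴱ : ∀ {A B C D} {S : Ref A} {T : Ref B} {U : Ref C} {V : Ref D}
             (α : EHom S T) (β : EHom T U) (γ : EHom U V) →
             (α ⨾ᴱ β) ⨾ᴱ γ ≡ α ⨾ᴱ (β ⨾ᴱ γ)
    p-id   : ∀ {A} {S : Ref A} → p (idᴱ {S = S}) ≡ id
    p-comp : ∀ {A B C} {S : Ref A} {T : Ref B} {U : Ref C} (α : EHom S T) (β : EHom T U) →
             p (α ⨾ᴱ β) ≡ p α ⨾ p β

  E : Category (o ⊔ r) e
  E = record
    { Obj = Σ Obj Ref
    ; Hom = λ X Y → EHom (proj₂ X) (proj₂ Y)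
    ; id = idᴱ
    ; _⨾_ = _⨾ᴱ_
    ; idˡ = idᴱˡ
    ; idʳ = idᴱʳ
    ; assoc = assocᴱ
    }

  infix 4 _⇒[_]_ _≤_ _≈ᴰ_
  _⇒[_]_ : ∀ {A B} → Ref A → Hom A B → Ref B → Set (h ⊔ e)
  S ⇒[ f ] T = Σ (EHom S T) (λ α → p α ≡ f)

  _≤_ : ∀ {A} → Ref A → Ref A → Set (h ⊔ e)
  S ≤ T = S ⇒[ id ] T

  _≈ᴰ_ : ∀ {A B} {S : Ref A} {f g : Hom A B} {T : Ref B} → S ⇒[ f ] T → S ⇒[ g ] T → Set e
  α ≈ᴰ β = proj₁ α ≡ proj₁ β

  idᴰ : ∀ {A} {T : Ref A} → T ≤ T
  idᴰ = idᴱ , p-id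

  infixr 9 _⨾ᴰ_
  _⨾ᴰ_ : ∀ {A B C} {S : Ref A} {T : Ref B} {U : Ref C} {f : Hom A B} {g : Hom B C} →
         S ⇒[ f ] T → T ⇒[ g ] U → S ⇒[ f ⨾ g ] U
  (α , pα) ⨾ᴰ (β , pβ) = (α ⨾ᴱ β) , trans (p-comp α β) (trans (cong (_⨾ _) pα) (cong (_ ⨾_) pβ))

  infixr 9 _⨾ᵛ_
  _⨾ᵛ_ : ∀ {A} {S T U : Ref A} → S ≤ T → T ≤ U → S ≤ U
  α ⨾ᵛ β = proj₁ (α ⨾ᴰ β) , trans (proj₂ (α ⨾ᴰ β)) (idˡ id)

  IsVerticalIso : ∀ {A} {S T : Ref A} → S ≤ T → Set (h ⊔ e)
  IsVerticalIso {S = S} {T} α =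
    Σ (T ≤ S) (λ β → (proj₁ α ⨾ᴱ proj₁ β ≡ idᴱ) × (proj₁ β ⨾ᴱ proj₁ α ≡ idᴱ))

record IsBifibration {o h r e : Level} {I : Category o h} (P : RefinementSystem I r e)
       : Set (o ⊔ h ⊔ r ⊔ e) where
  open Category I
  open RefinementSystem P
  field
    pull  : ∀ {A B} (f : Hom A B) → Ref B → Ref A
    cart  : ∀ {A B} (f : Hom A B) (T : Ref B) → pull f T ⇒[ f ] T
    cart-fac : ∀ {X A B} {S : Ref X} (f : Hom A B) {T : Ref B} (g : Hom X A) →
               S ⇒[ g ⨾ f ] T → S ⇒[ g ] pull f T
    cart-fac-comm : ∀ {X A B} {S : Ref X} (f : Hom A B) {T : Ref B} (g : Hom X A)
                    (α : S ⇒[ g ⨾ f ] T) → (cart-fac f g α ⨾ᴰ cart f T) ≈ᴰ α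
    cart-fac-unique : ∀ {X A B} {S : Ref X} (f : Hom A B) {T : Ref B} (g : Hom X A)
                      (α : S ⇒[ g ⨾ f ] T) (β : S ⇒[ g ] pull f T) →
                      (β ⨾ᴰ cart f T) ≈ᴰ α → β ≈ᴰ cart-fac f g α
    push  : ∀ {A B} (f : Hom A B) → Ref A → Ref B
    opcart : ∀ {A B} (f : Hom A B) (S : Ref A) → S ⇒[ f ] push f S
    opcart-fac : ∀ {A B Y} {S : Ref A} (f : Hom A B) {T : Ref Y} (g : Hom B Y) →
                 S ⇒[ f ⨾ g ] T → push f S ⇒[ g ] T
    opcart-fac-comm : ∀ {A B Y} {S : Ref A} (f : Hom A B) {T : Ref Y} (g : Hom B Y)
                      (α : S ⇒[ f ⨾ g ] T) → (opcart f S ⨾ᴰ opcart-fac f g α) ≈ᴰ α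
    opcart-fac-unique : ∀ {A B Y} {S : Ref A} (f : Hom A B) {T : Ref Y} (g : Hom B Y)
                        (α : S ⇒[ f ⨾ g ] T) (β : push f S ⇒[ g ] T) →
                        (opcart f S ⨾ᴰ β) ≈ᴰ α → β ≈ᴰ opcart-fac f g α

record IsMonoidalClosedRefinement {o h r e : Level} (ℐ : MonoidalClosedCategory o h)
       (P : RefinementSystem (MonoidalClosedCategory.cat ℐ) r e)
       : Set (o ⊔ h ⊔ r ⊔ e) where
  open MonoidalClosedCategory ℐ
  open RefinementSystem P
  field
    _⊗ᴿ_ : ∀ {A B} → Ref A → Ref B → Ref (A ⊗ B)
    𝟏ᴿ   : Ref 𝟏
    isMonoidalᴱ : IsMonoidal E (λ X Y → (proj₁ X ⊗ proj₁ Y , proj₂ X ⊗ᴿ proj₂ Y)) (𝟏 , 𝟏ᴿ)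
  module Mᴱ = IsMonoidal isMonoidalᴱ
  field
    p-⊗     : ∀ {A B A' B'} {S : Ref A} {T : Ref B} {S' : Ref A'} {T' : Ref B'}
              (α : EHom S T) (β : EHom S' T') → p (α Mᴱ.⊗₁ β) ≡ p α ⊗₁ p β
    p-assoc : ∀ {A B D} {S : Ref A} {T : Ref B} {U : Ref D} →
              p (Mᴱ.assocʳ {A , S} {B , T} {D , U}) ≡ assocʳ
    p-unitˡ : ∀ {A} {S : Ref A} → p (Mᴱ.unitˡ {A , S}) ≡ unitˡ
    p-unitʳ : ∀ {A} {S : Ref A} → p (Mᴱ.unitʳ {A , S}) ≡ unitʳ
    _⧹ᴿ_ : ∀ {A D} → Ref A → Ref D → Ref (A ⧹ D)
    _⧸ᴿ_ : ∀ {D B} → Ref D → Ref B → Ref (D ⧸ B)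
    isClosedᴱ : IsClosed E isMonoidalᴱ
                  (λ X Y → (proj₁ X ⧹ proj₁ Y , proj₂ X ⧹ᴿ proj₂ Y))
                  (λ X Y → (proj₁ X ⧸ proj₁ Y , proj₂ X ⧸ᴿ proj₂ Y))
  module Cᴱ = IsClosed isClosedᴱ
  field
    p-evˡ     : ∀ {A D} {S : Ref A} {U : Ref D} → p (Cᴱ.evˡ {A , S} {D , U}) ≡ evˡ
    p-curryˡ  : ∀ {A X D} {S : Ref A} {R : Ref X} {U : Ref D} (α : EHom (S ⊗ᴿ R) U) →
                p (Cᴱ.curryˡ {A , S} {X , R} {D , U} α) ≡ curryˡ (p α)
    p-evʳ     : ∀ {B D} {T : Ref B} {U : Ref D} → p (Cᴱ.evʳ {B , T} {D , U}) ≡ evʳ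
    p-curryʳ  : ∀ {B X D} {T : Ref B} {R : Ref X} {U : Ref D} (α : EHom (R ⊗ᴿ T) U) →
                p (Cᴱ.curryʳ {B , T} {X , R} {D , U} α) ≡ curryʳ (p α)

  _⊗ᴰ_ : ∀ {A B A' B'} {S : Ref A} {T : Ref B} {S' : Ref A'} {T' : Ref B'}
         {f : Hom A B} {g : Hom A' B'} → S ⇒[ f ] T → S' ⇒[ g ] T' →
         (S ⊗ᴿ S') ⇒[ f ⊗₁ g ] (T ⊗ᴿ T')
  (α , pα) ⊗ᴰ (β , pβ) = (α Mᴱ.⊗₁ β) , trans (p-⊗ α β) (trans (cong (_⊗₁ _) pα) (cong (_ ⊗₁_) pβ))

record PreservedByTensor {o h r e : Level} {ℐ : MonoidalClosedCategory o h}
       {P : RefinementSystem (MonoidalClosedCategory.cat ℐ) r e}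
       (F : IsBifibration P) (M : IsMonoidalClosedRefinement ℐ P)
       : Set (o ⊔ h ⊔ r ⊔ e) where
  open MonoidalClosedCategory ℐ
  open RefinementSystem P
  open IsBifibration F
  open IsMonoidalClosedRefinement M

  pull-cmp : ∀ {A B A' B'} (f : Hom A B) (g : Hom A' B') (T : Ref B) (U : Ref B') →
             (pull f T ⊗ᴿ pull g U) ≤ pull (f ⊗₁ g) (T ⊗ᴿ U)
  pull-cmp f g T U =
    cart-fac (f ⊗₁ g) id
      (proj₁ (cart f T ⊗ᴰ cart g U) , trans (proj₂ (cart f T ⊗ᴰ cart g U)) (sym (idˡ _)))

  push-cmp : ∀ {A B A' B'} (f : Hom A B) (g : Hom A' B') (S : Ref A) (T : Ref A') →
             push (f ⊗₁ g) (S ⊗ᴿ T) ≤ (push f S ⊗ᴿ push g T)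
  push-cmp f g S T =
    opcart-fac (f ⊗₁ g) id
      (proj₁ (opcart f S ⊗ᴰ opcart g T) , trans (proj₂ (opcart f S ⊗ᴰ opcart g T)) (sym (idʳ _)))

  field
    pull-⊗ : ∀ {A B A' B'} (f : Hom A B) (g : Hom A' B') (T : Ref B) (U : Ref B') →
             IsVerticalIso (pull-cmp f g T U)
    push-⊗ : ∀ {A B A' B'} (f : Hom A B) (g : Hom A' B') (S : Ref A) (T : Ref A') →
             IsVerticalIso (push-cmp f g S T)

record MonoidalClosedBifibration {o h : Level} (ℐ : MonoidalClosedCategory o h) (r e : Level)
       : Set (o ⊔ h ⊔ lsuc (r ⊔ e)) where
  field
    refinement    : RefinementSystem (MonoidalClosedCategory.cat ℐ) r e
    bifibration   : IsBifibration refinement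
    monoidalClosed : IsMonoidalClosedRefinement ℐ refinement
    preserved     : PreservedByTensor bifibration monoidalClosed
  open RefinementSystem refinement public
  open IsBifibration bifibration public
  open IsMonoidalClosedRefinement monoidalClosed public

record MonoidOn {o h : Level} (ℐ : MonoidalClosedCategory o h)
       (H : MonoidalClosedCategory.Obj ℐ) : Set h where
  open MonoidalClosedCategory ℐ
  field
    ⊛   : Hom (H ⊗ H) H
    emp : Hom 𝟏 H
    ⊛-assoc  : (⊛ ⊗₁ id) ⨾ ⊛ ≡ assocʳ ⨾ (id ⊗₁ ⊛) ⨾ ⊛
    ⊛-unitˡ  : (emp ⊗₁ id) ⨾ ⊛ ≡ unitˡ
    ⊛-unitʳ  : (id ⊗₁ emp) ⨾ ⊛ ≡ unitʳ

module SepLogic {o h r e : Level} {ℐ : MonoidalClosedCategory o h}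
                (P : MonoidalClosedBifibration ℐ r e)
                {H : MonoidalClosedCategory.Obj ℐ} (Mon : MonoidOn ℐ H) where
  open MonoidalClosedCategory ℐ
  open MonoidalClosedBifibration P
  open MonoidOn Mon

  infixr 10 _∗_ _-∗_
  _∗_ : Ref H → Ref H → Ref H
  S ∗ T = push ⊛ (S ⊗ᴿ T)

  _-∗_ : Ref H → Ref H → Ref H
  S -∗ T = pull (curryʳ ⊛) (T ⧸ᴿ S)

module Submission where

open import Defs
open import Data.Product using (Σ; _×_; proj₁; _,_)
open import Relation.Binary.PropositionalEquality using (_≡_; refl; sym; trans; cong; module ≡-Reasoning)

module Retyping {o h r e} {I : Category o h} (P : RefinementSystem I r e) where
  open Category I
  open RefinementSystem P

  retype : ∀ {A B} {S : Ref A} {T : Ref B} {f g : Hom A B} →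
           S ⇒[ f ] T → f ≡ g → S ⇒[ g ] T
  retype (α , pα) f≡g = α , trans pα f≡g

module BifibrationFacts {o h r e} {I : Category o h} {P : RefinementSystem I r e}
                        (F : IsBifibration P) where
  open Category I
  open RefinementSystem P
  open IsBifibration F
  open Retyping P

  opcart-ext : ∀ {A B Y} {S : Ref A} (f : Hom A B) {T : Ref Y} {g : Hom B Y}
               (β₁ β₂ : push f S ⇒[ g ] T) →
               (opcart f S ⨾ᴰ β₁) ≈ᴰ (opcart f S ⨾ᴰ β₂) → β₁ ≈ᴰ β₂
  opcart-ext f {g = g} β₁ β₂ eq =
    trans (opcart-fac-unique f g (opcart f _ ⨾ᴰ β₂) β₁ eq)
          (sym (opcart-fac-unique f g (opcart f _ ⨾ᴰ β₂) β₂ refl))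

  cart-ext : ∀ {X A B} {S : Ref X} (f : Hom A B) {T : Ref B} {g : Hom X A}
             (β₁ β₂ : S ⇒[ g ] pull f T) →
             (β₁ ⨾ᴰ cart f T) ≈ᴰ (β₂ ⨾ᴰ cart f T) → β₁ ≈ᴰ β₂
  cart-ext f {g = g} β₁ β₂ eq =
    trans (cart-fac-unique f g (β₂ ⨾ᴰ cart f _) β₁ eq)
          (sym (cart-fac-unique f g (β₂ ⨾ᴰ cart f _) β₂ refl))

  push-transpose : ∀ {A B} {S : Ref A} {T : Ref B} {f : Hom A B} →
                   S ⇒[ f ] T → push f S ≤ T
  push-transpose {f = f} α = opcart-fac f id (retype α (sym (idʳ f)))

  push-transpose-comm : ∀ {A B} {S : Ref A} {T : Ref B} {f : Hom A B} (α : S ⇒[ f ] T) →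
                        (opcart f S ⨾ᴰ push-transpose α) ≈ᴰ α
  push-transpose-comm {f = f} α = opcart-fac-comm f id (retype α (sym (idʳ f)))

  pull-transpose : ∀ {A B} {S : Ref A} {T : Ref B} {f : Hom A B} →
                   S ⇒[ f ] T → S ≤ pull f T
  pull-transpose {f = f} α = cart-fac f id (retype α (sym (idˡ f)))

  pull-transpose-comm : ∀ {A B} {S : Ref A} {T : Ref B} {f : Hom A B} (α : S ⇒[ f ] T) →
                        (pull-transpose α ⨾ᴰ cart f T) ≈ᴰ α
  pull-transpose-comm {f = f} α = cart-fac-comm f id (retype α (sym (idˡ f)))

module ResidualDerivations {o h r e} {ℐ : MonoidalClosedCategory o h}
                           (P : MonoidalClosedBifibration ℐ r e) where
  open MonoidalClosedCategory ℐ
  open MonoidalClosedBifibration P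

  evᴰ : ∀ {B D} {T : Ref B} {U : Ref D} → ((U ⧸ᴿ T) ⊗ᴿ T) ⇒[ evʳ ] U
  evᴰ = Cᴱ.evʳ , p-evʳ

  curryᴰ : ∀ {B X D} {R : Ref X} {T : Ref B} {U : Ref D} {f : Hom (X ⊗ B) D} →
           (R ⊗ᴿ T) ⇒[ f ] U → R ⇒[ curryʳ f ] (U ⧸ᴿ T)
  curryᴰ (α , pα) = Cᴱ.curryʳ α , trans (p-curryʳ α) (cong curryʳ pα)

module Residuation {o h r e} {ℐ : MonoidalClosedCategory o h}
                   (P : MonoidalClosedBifibration ℐ r e)
                   {A B C : MonoidalClosedCategory.Obj ℐ}
                   (f : MonoidalClosedCategory.Hom ℐ (MonoidalClosedCategory._⊗_ ℐ A B) C) where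
  open MonoidalClosedCategory ℐ
  open MonoidalClosedBifibration P
  open Retyping refinement
  open BifibrationFacts bifibration
  open ResidualDerivations P

  ι : ∀ {S : Ref A} {T : Ref B} → EHom (S ⊗ᴿ T) (push f (S ⊗ᴿ T))
  ι {S} {T} = proj₁ (opcart f (S ⊗ᴿ T))

  π : ∀ {T : Ref B} {U : Ref C} → EHom (pull (curryʳ f) (U ⧸ᴿ T)) (U ⧸ᴿ T)
  π {T} {U} = proj₁ (cart (curryʳ f) (U ⧸ᴿ T))

  M∗ : ∀ {S₁ T₁ : Ref A} {S₂ T₂ : Ref B} →
       S₁ ≤ T₁ → S₂ ≤ T₂ → push f (S₁ ⊗ᴿ S₂) ≤ push f (T₁ ⊗ᴿ T₂)
  M∗ {T₁ = T₁} {T₂ = T₂} a b =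
    push-transpose (retype ((a ⊗ᴰ b) ⨾ᴰ opcart f (T₁ ⊗ᴿ T₂))
                           (trans (cong (_⨾ f) ⊗-id) (idˡ f)))

  M∗-comm : ∀ {S₁ T₁ : Ref A} {S₂ T₂ : Ref B} (a : S₁ ≤ T₁) (b : S₂ ≤ T₂) →
            ι ⨾ᴱ proj₁ (M∗ a b) ≡ (proj₁ a Mᴱ.⊗₁ proj₁ b) ⨾ᴱ ι
  M∗-comm a b = push-transpose-comm _

  Φ : ∀ {S : Ref A} {T : Ref B} {U : Ref C} →
      push f (S ⊗ᴿ T) ≤ U → S ≤ pull (curryʳ f) (U ⧸ᴿ T)
  Φ {S} {T} β = pull-transpose (curryᴰ (retype (opcart f (S ⊗ᴿ T) ⨾ᴰ β) (idʳ f)))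

  Φ-comm : ∀ {S : Ref A} {T : Ref B} {U : Ref C} (β : push f (S ⊗ᴿ T) ≤ U) →
           proj₁ (Φ β) ⨾ᴱ π ≡ Cᴱ.curryʳ (ι ⨾ᴱ proj₁ β)
  Φ-comm β = pull-transpose-comm _

  -- The counit: ρ(f)^*(U ⧸ T) ⊗ T ⇒_f U obtained as (π ⊗ id) ; ev,
  -- which lies over (ρ(f) ⊗ id) ; evʳ = f, pushed to a vertical derivation.
  ε : ∀ {T : Ref B} {U : Ref C} → push f (pull (curryʳ f) (U ⧸ᴿ T) ⊗ᴿ T) ≤ U
  ε {T} {U} = push-transpose (retype ((cart (curryʳ f) (U ⧸ᴿ T) ⊗ᴰ idᴰ {T = T}) ⨾ᴰ evᴰ) (βʳ f))

  ε-comm : ∀ {T : Ref B} {U : Ref C} → ι ⨾ᴱ proj₁ (ε {T} {U}) ≡ (π Mᴱ.⊗₁ idᴱ) ⨾ᴱ Cᴱ.evʳ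
  ε-comm = push-transpose-comm _

  uncurry-via-ε : ∀ {S : Ref A} {T : Ref B} {U : Ref C} (η : S ≤ pull (curryʳ f) (U ⧸ᴿ T)) →
                  ι ⨾ᴱ proj₁ (M∗ η (idᴰ {T = T}) ⨾ᵛ ε {T} {U})
                    ≡ ((proj₁ η ⨾ᴱ π) Mᴱ.⊗₁ idᴱ) ⨾ᴱ Cᴱ.evʳ
  uncurry-via-ε {S} {T} {U} η = begin
    ι ⨾ᴱ (μ ⨾ᴱ ε′)                               ≡⟨ sym (assocᴱ ι μ ε′) ⟩
    (ι ⨾ᴱ μ) ⨾ᴱ ε′                               ≡⟨ cong (_⨾ᴱ ε′) (M∗-comm η idᴰ) ⟩
    ((η′ Mᴱ.⊗₁ idᴱ) ⨾ᴱ ι) ⨾ᴱ ε′                  ≡⟨ assocᴱ (η′ Mᴱ.⊗₁ idᴱ) ι ε′ ⟩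
    (η′ Mᴱ.⊗₁ idᴱ) ⨾ᴱ (ι ⨾ᴱ ε′)                  ≡⟨ cong ((η′ Mᴱ.⊗₁ idᴱ) ⨾ᴱ_) ε-comm ⟩
    (η′ Mᴱ.⊗₁ idᴱ) ⨾ᴱ ((π Mᴱ.⊗₁ idᴱ) ⨾ᴱ Cᴱ.evʳ)  ≡⟨ sym (assocᴱ (η′ Mᴱ.⊗₁ idᴱ) (π Mᴱ.⊗₁ idᴱ) Cᴱ.evʳ) ⟩
    ((η′ Mᴱ.⊗₁ idᴱ) ⨾ᴱ (π Mᴱ.⊗₁ idᴱ)) ⨾ᴱ Cᴱ.evʳ  ≡⟨ cong (_⨾ᴱ Cᴱ.evʳ) (sym (Mᴱ.⊗-comp η′ π idᴱ idᴱ)) ⟩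
    ((η′ ⨾ᴱ π) Mᴱ.⊗₁ (idᴱ ⨾ᴱ idᴱ)) ⨾ᴱ Cᴱ.evʳ     ≡⟨ cong (λ i → ((η′ ⨾ᴱ π) Mᴱ.⊗₁ i) ⨾ᴱ Cᴱ.evʳ) (idᴱˡ idᴱ) ⟩
    ((η′ ⨾ᴱ π) Mᴱ.⊗₁ idᴱ) ⨾ᴱ Cᴱ.evʳ              ∎
    where
    open ≡-Reasoning
    η′ : EHom S (pull (curryʳ f) (U ⧸ᴿ T))
    η′ = proj₁ η
    μ : EHom (push f (S ⊗ᴿ T)) (push f (pull (curryʳ f) (U ⧸ᴿ T) ⊗ᴿ T))
    μ = proj₁ (M∗ η (idᴰ {T = T}))
    ε′ : EHom (push f (pull (curryʳ f) (U ⧸ᴿ T) ⊗ᴿ T)) U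
    ε′ = proj₁ (ε {T} {U})

  counit-after-Φ : ∀ {S : Ref A} {T : Ref B} {U : Ref C} (β : push f (S ⊗ᴿ T) ≤ U) →
                   (M∗ (Φ β) (idᴰ {T = T}) ⨾ᵛ ε {T} {U}) ≈ᴰ β
  counit-after-Φ {T = T} {U} β = opcart-ext f (M∗ (Φ β) (idᴰ {T = T}) ⨾ᵛ ε {T} {U}) β (begin
    ι ⨾ᴱ proj₁ (M∗ (Φ β) idᴰ ⨾ᵛ ε)             ≡⟨ uncurry-via-ε (Φ β) ⟩
    ((proj₁ (Φ β) ⨾ᴱ π) Mᴱ.⊗₁ idᴱ) ⨾ᴱ Cᴱ.evʳ   ≡⟨ cong (λ k → (k Mᴱ.⊗₁ idᴱ) ⨾ᴱ Cᴱ.evʳ) (Φ-comm β) ⟩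
    (Cᴱ.curryʳ (ι ⨾ᴱ proj₁ β) Mᴱ.⊗₁ idᴱ) ⨾ᴱ Cᴱ.evʳ ≡⟨ Cᴱ.βʳ _ ⟩
    ι ⨾ᴱ proj₁ β                              ∎)
    where open ≡-Reasoning

  Φ-after-counit : ∀ {S : Ref A} {T : Ref B} {U : Ref C} (η : S ≤ pull (curryʳ f) (U ⧸ᴿ T)) →
                   Φ (M∗ η (idᴰ {T = T}) ⨾ᵛ ε {T} {U}) ≈ᴰ η
  Φ-after-counit {T = T} {U} η = cart-ext (curryʳ f) (Φ (M∗ η (idᴰ {T = T}) ⨾ᵛ ε {T} {U})) η (begin
    proj₁ (Φ (M∗ η idᴰ ⨾ᵛ ε)) ⨾ᴱ π             ≡⟨ Φ-comm _ ⟩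
    Cᴱ.curryʳ (ι ⨾ᴱ proj₁ (M∗ η idᴰ ⨾ᵛ ε))      ≡⟨ cong Cᴱ.curryʳ (uncurry-via-ε η) ⟩
    Cᴱ.curryʳ (((proj₁ η ⨾ᴱ π) Mᴱ.⊗₁ idᴱ) ⨾ᴱ Cᴱ.evʳ) ≡⟨ Cᴱ.ηʳ _ ⟩
    proj₁ η ⨾ᴱ π                              ∎)
    where open ≡-Reasoning

mainTheorem6 :
  ∀ {o h r e} (ℐ : MonoidalClosedCategory o h) (P : MonoidalClosedBifibration ℐ r e)
    (H : MonoidalClosedCategory.Obj ℐ) (Mon : MonoidOn ℐ H) →
    let open MonoidalClosedBifibration P
        open SepLogic P Mon
    in Σ (∀ {S₁ T₁ S₂ T₂ : Ref H} → S₁ ≤ T₁ → S₂ ≤ T₂ → (S₁ ∗ S₂) ≤ (T₁ ∗ T₂)) λ M∗ →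
       Σ (∀ {S T U : Ref H} → (S ∗ T) ≤ U → S ≤ (T -∗ U)) λ Φ →
       Σ (∀ {T U : Ref H} → ((T -∗ U) ∗ T) ≤ U) λ ε →
         (∀ {S T U : Ref H} (β : (S ∗ T) ≤ U) →
            (M∗ (Φ β) (idᴰ {T = T}) ⨾ᵛ ε {T} {U}) ≈ᴰ β)
       × (∀ {S T U : Ref H} (η : S ≤ (T -∗ U)) →
            Φ (M∗ η (idᴰ {T = T}) ⨾ᵛ ε {T} {U}) ≈ᴰ η)
mainTheorem6 ℐ P H Mon =
  (λ {S₁} {T₁} {S₂} {T₂} → M∗ {S₁} {T₁} {S₂} {T₂}) ,
  (λ {S} {T} {U} → Φ {S} {T} {U}) ,
  (λ {T} {U} → ε {T} {U}) ,
  (λ {S} {T} {U} → counit-after-Φ {S} {T} {U}) ,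
  (λ {S} {T} {U} → Φ-after-counit {S} {T} {U})
  where open Residuation P (MonoidOn.⊛ Mon)
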